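{- Let $k_1,\ldots,k_n\ge 2$ be integers, $G=[0,k_1-1]\times\cdots\times[0,k_n-1]$ and $N=\sum_{i=1}^n(k_i-1)$. Let $d\in[0,\lfloor N/2\rfloor]$ and let $E\subseteq[N-d+1,N]$ be nonempty. Then \[ \operatorname{rank}(\mathrm{Ev}_{\{d\},E})=\operatorname{rank}(\mathrm{Ev}_{\{d\},\{\min E\}}). \]
   Context: For integers $a\le b$, $[a,b]$ is the set of integers between $a$ and $b$. For $x\in G$, $\mathrm{wt}(x)=\sum_i x_i$, and for a set of integers $F$, $\underline{F}=\{x\in G:\mathrm{wt}(x)\in F\}$. For $i\in[n]$ and $a\in\mathbb{N}$, $Y_i^{(a)}=X_i(X_i-1)\cdots(X_i-a+1)$, and for $\alpha\in\mathbb{N}^n$, $\mathbb{Y}^{(\alpha)}=\prod_{i=1}^n Y_i^{(\alpha_i)}$. For $D,E\subseteq[0,N]$, $\mathrm{Ev}_{D,E}$ is the real matrix with rows indexed by $\underline{D}$ and columns by $\underline{E}$, with entries $\mathrm{Ev}_{D,E}(\alpha,\beta)=\mathbb{Y}^{(\alpha)}(\beta)=\prod_i\alpha_i!\binom{\beta_i}{\alpha_i}$. -}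

module Defs where

open import Data.Nat using (ℕ; zero; suc; _!) renaming (_+_ to _+ℕ_; _*_ to _*ℕ_)
open import Data.Nat.Combinatorics using (_C_)
open import Data.Fin using (Fin; toℕ) renaming (zero to fz; suc to fs)
open import Data.Integer using (+_)
open import Data.Rational using (ℚ; 0ℚ; _+_; _*_; _/_)
open import Data.Product using (Σ; ∃; _×_)
open import Relation.Binary.PropositionalEquality using (_≡_)
open import Relation.Nullary using (¬_)

sumFinℕ : (n : ℕ) → (Fin n → ℕ) → ℕ
sumFinℕ zero f = 0
sumFinℕ (suc n) f = f fz +ℕ sumFinℕ n (λ i → f (fs i))

prodFinℕ : (n : ℕ) → (Fin n → ℕ) → ℕ
prodFinℕ zero f = 1
prodFinℕ (suc n) f = f fz *ℕ prodFinℕ n (λ i → f (fs i))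

sumFinℚ : (n : ℕ) → (Fin n → ℚ) → ℚ
sumFinℚ zero f = 0ℚ
sumFinℚ (suc n) f = f fz + sumFinℚ n (λ i → f (fs i))

G : (n : ℕ) → (Fin n → ℕ) → Set
G n k = (i : Fin n) → Fin (k i)

wt : {n : ℕ} {k : Fin n → ℕ} → G n k → ℕ
wt {n} x = sumFinℕ n (λ i → toℕ (x i))

Ntot : (n : ℕ) → (Fin n → ℕ) → ℕ
Ntot n k = sumFinℕ n (λ i → k i Data.Nat.∸ 1)
  where import Data.Nat

Under : (n : ℕ) (k : Fin n → ℕ) → (ℕ → Set) → Set
Under n k F = Σ (G n k) (λ x → F (wt x))

Yval : (n : ℕ) (k : Fin n → ℕ) → G n k → G n k → ℕ
Yval n k α β = prodFinℕ n (λ i → (toℕ (α i)) ! *ℕ (toℕ (β i) C toℕ (α i)))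

ℕtoℚ : ℕ → ℚ
ℕtoℚ m = + m / 1

Ev : (n : ℕ) (k : Fin n → ℕ) (D E : ℕ → Set) → Under n k D → Under n k E → ℚ
Ev n k D E (α Data.Product., _) (β Data.Product., _) = ℕtoℚ (Yval n k α β)
  where import Data.Product

LinIndepRows : {R C : Set} → (R → C → ℚ) → {r : ℕ} → (Fin r → R) → Set
LinIndepRows {R} {C} M {r} f =
  (c : Fin r → ℚ) → ((β : C) → sumFinℚ r (λ j → c j * M (f j) β) ≡ 0ℚ) → (j : Fin r) → c j ≡ 0ℚ

HasRank : {R C : Set} → (R → C → ℚ) → ℕ → Set
HasRank {R} M r =
  (Σ (Fin r → R) (λ f → LinIndepRows M f)) × ((f : Fin (suc r) → R) → ¬ LinIndepRows M f)

{-# OPTIONS --safe #-}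
module Submission where

-- In each coordinate
-- x·Y^(a)(x−1) + a·Y^(a)(x) = x·Y^(a)(x), so every linear combination S of rows satisfies
-- Σ_i β_i S(β − e_i) + d·S(β) = wt(β)·S(β). As d < m, a combination vanishing on all columns of
-- weight m therefore vanishes, by induction on the weight, on all columns of weight ≥ m.
-- Since d ≤ ⌊N/2⌋ < N − d + 1 ≤ m = min E and m ∈ E, a family of rows is linearly independent
-- in Ev_{{d},E} iff it is in Ev_{{d},{m}}, so the two matrices have the same rank. That rank
-- exists because the matrices are finite: Gaussian elimination yields a basis of the row space,
-- and r + 1 vectors in the span of r vectors are dependent.

open import Defs
open import Data.Fin using (Fin; punchIn) renaming (zero to fz; suc to fs)
open import Data.Nat using (ℕ; zero; suc)
open import Data.Product using (Σ; _×_; _,_; proj₁; proj₂)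
open import Function using (_∘_)
open import Relation.Binary.PropositionalEquality
open import Relation.Nullary using (¬_; yes; no; contradiction)

module RationalSums where

  open import Algebra.Bundles using (CommutativeRing)
  import Algebra.Properties.Semiring.Sum as SemiringSum
  import Data.Integer as ℤ
  import Data.Integer.Properties as ℤ
  open import Data.Nat.Coprimality using (1-coprimeTo) renaming (sym to coprime-sym)
  open import Data.Rational using (ℚ; 0ℚ; 1ℚ; mkℚ; ↥_; _+_; _*_; _/_; 1/_; ≢-nonZero)
  import Data.Rational.Properties as ℚ
  open import Data.Vec.Functional using (removeAt)
  import Data.Nat as ℕ
  import Data.Nat.Properties as ℕ

  private module ℚΣ = SemiringSum (CommutativeRing.semiring ℚ.+-*-commutativeRing)

  sumFinℚ≡sum : ∀ n (f : Fin n → ℚ) → sumFinℚ n f ≡ ℚΣ.sum f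
  sumFinℚ≡sum zero    f = refl
  sumFinℚ≡sum (suc n) f = cong (f fz +_) (sumFinℚ≡sum n (f ∘ fs))

  sumFinℚ-cong : ∀ n {f g : Fin n → ℚ} → (∀ i → f i ≡ g i) → sumFinℚ n f ≡ sumFinℚ n g
  sumFinℚ-cong n {f} {g} f≗g = begin
    sumFinℚ n f  ≡⟨ sumFinℚ≡sum n f ⟩
    ℚΣ.sum f     ≡⟨ ℚΣ.sum-cong-≗ f≗g ⟩
    ℚΣ.sum g     ≡⟨ sumFinℚ≡sum n g ⟨
    sumFinℚ n g  ∎
    where open ≡-Reasoning

  sumFinℚ-zero : ∀ n {f : Fin n → ℚ} → (∀ i → f i ≡ 0ℚ) → sumFinℚ n f ≡ 0ℚ
  sumFinℚ-zero zero    f≡0 = refl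
  sumFinℚ-zero (suc n) f≡0 = cong₂ _+_ (f≡0 fz) (sumFinℚ-zero n (f≡0 ∘ fs))

  *-distribˡ-sumFinℚ : ∀ n x (f : Fin n → ℚ) → x * sumFinℚ n f ≡ sumFinℚ n (λ i → x * f i)
  *-distribˡ-sumFinℚ n x f rewrite sumFinℚ≡sum n f | sumFinℚ≡sum n (λ i → x * f i) =
    ℚΣ.*-distribˡ-sum x f

  *-distribʳ-sumFinℚ : ∀ n x (f : Fin n → ℚ) → sumFinℚ n f * x ≡ sumFinℚ n (λ i → f i * x)
  *-distribʳ-sumFinℚ n x f rewrite sumFinℚ≡sum n f | sumFinℚ≡sum n (λ i → f i * x) =
    ℚΣ.*-distribʳ-sum x f

  sumFinℚ-distrib-+ : ∀ n (f g : Fin n → ℚ) →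
                      sumFinℚ n (λ i → f i + g i) ≡ sumFinℚ n f + sumFinℚ n g
  sumFinℚ-distrib-+ n f g
    rewrite sumFinℚ≡sum n f | sumFinℚ≡sum n g | sumFinℚ≡sum n (λ i → f i + g i) =
    ℚΣ.∑-distrib-+ f g

  sumFinℚ-comm : ∀ m n (f : Fin m → Fin n → ℚ) →
                 sumFinℚ m (λ i → sumFinℚ n (f i)) ≡ sumFinℚ n (λ j → sumFinℚ m (λ i → f i j))
  sumFinℚ-comm m n f = begin
    sumFinℚ m (λ i → sumFinℚ n (f i))            ≡⟨ sumFinℚ≡sum m _ ⟩
    ℚΣ.sum (λ i → sumFinℚ n (f i))               ≡⟨ ℚΣ.sum-cong-≗ (λ i → sumFinℚ≡sum n (f i)) ⟩
    ℚΣ.sum (λ i → ℚΣ.sum (f i))                  ≡⟨ ℚΣ.∑-comm f ⟩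
    ℚΣ.sum (λ j → ℚΣ.sum (λ i → f i j))          ≡⟨ ℚΣ.sum-cong-≗ (λ j → sumFinℚ≡sum m (λ i → f i j)) ⟨
    ℚΣ.sum (λ j → sumFinℚ m (λ i → f i j))       ≡⟨ sumFinℚ≡sum n _ ⟨
    sumFinℚ n (λ j → sumFinℚ m (λ i → f i j))    ∎
    where open ≡-Reasoning

  sumFinℚ-remove : ∀ n (i : Fin (suc n)) (f : Fin (suc n) → ℚ) →
                   sumFinℚ (suc n) f ≡ f i + sumFinℚ n (removeAt f i)
  sumFinℚ-remove n i f rewrite sumFinℚ≡sum (suc n) f | sumFinℚ≡sum n (removeAt f i) =
    ℚΣ.sum-remove f

  p*q≡0⇒p≡0 : ∀ p q → q ≢ 0ℚ → p * q ≡ 0ℚ → p ≡ 0ℚ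
  p*q≡0⇒p≡0 p q q≢0 pq≡0 = begin
    p                ≡⟨ ℚ.*-identityʳ p ⟨
    p * 1ℚ           ≡⟨ cong (p *_) (ℚ.*-inverseʳ q) ⟨
    p * (q * 1/ q)   ≡⟨ ℚ.*-assoc p q (1/ q) ⟨
    (p * q) * 1/ q   ≡⟨ cong (_* 1/ q) pq≡0 ⟩
    0ℚ * 1/ q        ≡⟨ ℚ.*-zeroˡ (1/ q) ⟩
    0ℚ               ∎
    where
    open ≡-Reasoning
    instance _ = ≢-nonZero q≢0


  ℕtoℚ≡mkℚ : ∀ m → ℕtoℚ m ≡ mkℚ (ℤ.+ m) 0 (coprime-sym (1-coprimeTo m))
  ℕtoℚ≡mkℚ m = ℚ.normalize-coprime (coprime-sym (1-coprimeTo m))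

  -- On normal forms mkℚ (+ a) 0 _, _+_ and _*_ compute to a single _/ 1, so these laws come from ℤ.
  ℕtoℚ-+ : ∀ a b → ℕtoℚ (a ℕ.+ b) ≡ ℕtoℚ a + ℕtoℚ b
  ℕtoℚ-+ a b = trans (cong (_/ 1) (trans (ℤ.pos-+ a b) (sym (cong₂ ℤ._+_ (ℤ.*-identityʳ (ℤ.+ a))
                                                                       (ℤ.*-identityʳ (ℤ.+ b))))))
                     (sym (cong₂ _+_ (ℕtoℚ≡mkℚ a) (ℕtoℚ≡mkℚ b)))

  ℕtoℚ-* : ∀ a b → ℕtoℚ (a ℕ.* b) ≡ ℕtoℚ a * ℕtoℚ b
  ℕtoℚ-* a b = trans (cong (_/ 1) (ℤ.pos-* a b)) (sym (cong₂ _*_ (ℕtoℚ≡mkℚ a) (ℕtoℚ≡mkℚ b)))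

  ℕtoℚ-sum : ∀ n (f : Fin n → ℕ) → ℕtoℚ (sumFinℕ n f) ≡ sumFinℚ n (ℕtoℚ ∘ f)
  ℕtoℚ-sum zero    f = refl
  ℕtoℚ-sum (suc n) f = trans (ℕtoℚ-+ (f fz) _) (cong (ℕtoℚ (f fz) +_) (ℕtoℚ-sum n (f ∘ fs)))

  ℕtoℚ-suc≢0 : ∀ n → ℕtoℚ (suc n) ≢ 0ℚ
  ℕtoℚ-suc≢0 n eq with cong ↥_ (trans (sym (ℕtoℚ≡mkℚ (suc n))) eq)
  ... | ()

  ℕtoℚ-*-cancel : ∀ {d w} x → d ℕ.< w → ℕtoℚ d * x ≡ ℕtoℚ w * x → x ≡ 0ℚ
  ℕtoℚ-*-cancel {d} {w} x d<w dx≡wx with ℕ.m≤n⇒∃[o]m+o≡n d<w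
  ... | e , 1+d+e≡w = p*q≡0⇒p≡0 x (ℕtoℚ (suc e)) (ℕtoℚ-suc≢0 e)
    (trans (ℚ.*-comm x _) (identityʳ-unique (ℕtoℚ d * x) _ (sym (begin
      ℕtoℚ d * x                        ≡⟨ dx≡wx ⟩
      ℕtoℚ w * x                        ≡⟨ cong (λ v → ℕtoℚ v * x) (trans (ℕ.+-suc d e) 1+d+e≡w) ⟨
      ℕtoℚ (d ℕ.+ suc e) * x            ≡⟨ cong (_* x) (ℕtoℚ-+ d (suc e)) ⟩
      (ℕtoℚ d + ℕtoℚ (suc e)) * x       ≡⟨ ℚ.*-distribʳ-+ x (ℕtoℚ d) _ ⟩
      ℕtoℚ d * x + ℕtoℚ (suc e) * x     ∎))))
    where
    open ≡-Reasoning
    open import Algebra.Properties.Group ℚ.+-0-group using (identityʳ-unique)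

module RowRank where

  open RationalSums
  open import Data.Fin.Properties using (¬∀⟶∃¬) renaming (all? to allFin?)
  open import Data.List using (List; length; lookup)
  open import Data.List.Membership.Propositional using (_∈_; find)
  open import Data.List.Relation.Unary.All as All using (All; all?)
  open import Data.List.Relation.Unary.All.Properties using (¬All⇒Any¬)
  open import Data.List.Relation.Unary.Any as Any using (Any)
  open import Data.List.Relation.Unary.Any.Properties using (lookup-index)
  open import Data.Rational using (ℚ; 0ℚ; 1ℚ; _+_; _*_; -_; _-_; 1/_; ≢-nonZero)
  import Data.Rational.Properties as ℚ
  open import Data.Rational.Properties using (_≟_)
  open import Data.Rational.Solver using (module +-*-Solver)
  open import Data.Vec.Functional using (insertAt; _∷_)
  open import Data.Vec.Functional.Properties using (insertAt-lookup; insertAt-punchIn)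

  RowRelation : {R C : Set} → (R → C → ℚ) → {r : ℕ} → (Fin r → R) → (Fin r → ℚ) → Set
  RowRelation {C = C} M {r} f c = (β : C) → sumFinℚ r (λ j → c j * M (f j) β) ≡ 0ℚ

  InSpan : {R C : Set} → (R → C → ℚ) → {r : ℕ} → (Fin r → R) → R → Set
  InSpan {C = C} M {r} f x = Σ (Fin r → ℚ) λ a → (β : C) → M x β ≡ sumFinℚ r (λ j → a j * M (f j) β)

  linIndepRows-mono : ∀ {R C C′ : Set} {M : R → C → ℚ} {M′ : R → C′ → ℚ} {r} {f : Fin r → R} →
                      (∀ c → RowRelation M′ f c → RowRelation M f c) →
                      LinIndepRows M f → LinIndepRows M′ f
  linIndepRows-mono M′⇒M ind c = ind c ∘ M′⇒M c

  hasRank-transfer : ∀ {R C C′ : Set} {M : R → C → ℚ} {M′ : R → C′ → ℚ} {r} →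
                     (∀ {s} (f : Fin s → R) c → RowRelation M f c → RowRelation M′ f c) →
                     (∀ {s} (f : Fin s → R) c → RowRelation M′ f c → RowRelation M f c) →
                     HasRank M r → HasRank M′ r
  hasRank-transfer {M = M} {M′} M⇒M′ M′⇒M ((f , ind) , maximal) =
    (f , linIndepRows-mono {M = M} {M′} {f = f} (M′⇒M f) ind) ,
    λ g ind′ → maximal g (linIndepRows-mono {M = M′} {M} {f = g} (M⇒M′ g) ind′)

  linIndepRows-coefficients : ∀ {R C : Set} {M : R → C → ℚ} {s r} (u : Fin s → R) (f : Fin r → R)
                              (a : Fin s → Fin r → ℚ) →
                              (∀ i β → M (u i) β ≡ sumFinℚ r (λ j → a i j * M (f j) β)) →
                              LinIndepRows M u → LinIndepRows a (λ i → i)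
  linIndepRows-coefficients {M = M} {s} {r} u f a u≡af ind c rel = ind c λ β → begin
    sumFinℚ s (λ i → c i * M (u i) β)
      ≡⟨ sumFinℚ-cong s (λ i → cong (c i *_) (u≡af i β)) ⟩
    sumFinℚ s (λ i → c i * sumFinℚ r (λ j → a i j * M (f j) β))
      ≡⟨ sumFinℚ-cong s (λ i → *-distribˡ-sumFinℚ r (c i) _) ⟩
    sumFinℚ s (λ i → sumFinℚ r (λ j → c i * (a i j * M (f j) β)))
      ≡⟨ sumFinℚ-comm s r _ ⟩
    sumFinℚ r (λ j → sumFinℚ s (λ i → c i * (a i j * M (f j) β)))
      ≡⟨ sumFinℚ-cong r (λ j → sumFinℚ-cong s (λ i → ℚ.*-assoc (c i) (a i j) _)) ⟨
    sumFinℚ r (λ j → sumFinℚ s (λ i → c i * a i j * M (f j) β))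
      ≡⟨ sumFinℚ-cong r (λ j → *-distribʳ-sumFinℚ s (M (f j) β) _) ⟨
    sumFinℚ r (λ j → sumFinℚ s (λ i → c i * a i j) * M (f j) β)
      ≡⟨ sumFinℚ-zero r (λ j → trans (cong (_* M (f j) β) (rel j)) (ℚ.*-zeroˡ (M (f j) β))) ⟩
    0ℚ ∎
    where open ≡-Reasoning

  module Pivot {R : Set} {c : ℕ} (M : R → Fin (suc c) → ℚ) (p : R) (pivot≢0 : M p fz ≢ 0ℚ) where

    private instance _ = ≢-nonZero pivot≢0

    ratio : R → ℚ
    ratio x = M x fz * 1/ M p fz

    ratio-* : ∀ x → ratio x * M p fz ≡ M x fz
    ratio-* x = begin
      M x fz * 1/ M p fz * M p fz    ≡⟨ ℚ.*-assoc (M x fz) _ _ ⟩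
      M x fz * (1/ M p fz * M p fz)  ≡⟨ cong (M x fz *_) (ℚ.*-inverseˡ (M p fz)) ⟩
      M x fz * 1ℚ                    ≡⟨ ℚ.*-identityʳ (M x fz) ⟩
      M x fz                         ∎
      where open ≡-Reasoning

    reduce : R → Fin c → ℚ
    reduce x col = M x (fs col) - ratio x * M p (fs col)

    module _ {s} (g : Fin s → R) (b : Fin (suc s) → ℚ) where

      weight : ℚ
      weight = b fz + sumFinℚ s (λ j → b (fs j) * ratio (g j))

      combination-pivotColumn : sumFinℚ (suc s) (λ j → b j * M ((p ∷ g) j) fz) ≡ weight * M p fz
      combination-pivotColumn = begin
        b fz * M p fz + sumFinℚ s (λ j → b (fs j) * M (g j) fz)
          ≡⟨ cong (b fz * M p fz +_) (sumFinℚ-cong s (λ j → cong (b (fs j) *_) (ratio-* (g j)))) ⟨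
        b fz * M p fz + sumFinℚ s (λ j → b (fs j) * (ratio (g j) * M p fz))
          ≡⟨ cong (b fz * M p fz +_) (sumFinℚ-cong s (λ j → ℚ.*-assoc (b (fs j)) _ _)) ⟨
        b fz * M p fz + sumFinℚ s (λ j → b (fs j) * ratio (g j) * M p fz)
          ≡⟨ cong (b fz * M p fz +_) (*-distribʳ-sumFinℚ s (M p fz) _) ⟨
        b fz * M p fz + sumFinℚ s (λ j → b (fs j) * ratio (g j)) * M p fz
          ≡⟨ ℚ.*-distribʳ-+ (M p fz) (b fz) (sumFinℚ s (λ j → b (fs j) * ratio (g j))) ⟨
        weight * M p fz ∎
        where open ≡-Reasoning

      combination-reducedColumn : ∀ col →
        sumFinℚ (suc s) (λ j → b j * M ((p ∷ g) j) (fs col)) ≡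
        weight * M p (fs col) + sumFinℚ s (λ j → b (fs j) * reduce (g j) col)
      combination-reducedColumn col = begin
        b fz * y + sumFinℚ s (λ j → b (fs j) * M (g j) (fs col))
          ≡⟨ cong (b fz * y +_) (sumFinℚ-cong s λ j →
               split (b (fs j)) (M (g j) (fs col)) (ratio (g j)) y) ⟩
        b fz * y + sumFinℚ s (λ j → b (fs j) * ratio (g j) * y + b (fs j) * reduce (g j) col)
          ≡⟨ cong (b fz * y +_) (sumFinℚ-distrib-+ s _ _) ⟩
        b fz * y + (sumFinℚ s (λ j → b (fs j) * ratio (g j) * y) + B)
          ≡⟨ cong (λ z → b fz * y + (z + B)) (*-distribʳ-sumFinℚ s y _) ⟨
        b fz * y + (sumFinℚ s (λ j → b (fs j) * ratio (g j)) * y + B)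
          ≡⟨ regroup (b fz) (sumFinℚ s (λ j → b (fs j) * ratio (g j))) y B ⟩
        weight * y + B ∎
        where
        open ≡-Reasoning
        open +-*-Solver
        y = M p (fs col)
        B = sumFinℚ s (λ j → b (fs j) * reduce (g j) col)
        split : ∀ β m t y → β * m ≡ β * t * y + β * (m - t * y)
        split = solve 4 (λ β m t y → β :* m := β :* t :* y :+ β :* (m :- t :* y)) refl
        regroup : ∀ a S y B → a * y + (S * y + B) ≡ (a + S) * y + B
        regroup = solve 4 (λ a S y B → a :* y :+ (S :* y :+ B) := (a :+ S) :* y :+ B) refl

      private
        0*y+B≡B : ∀ y B → 0ℚ * y + B ≡ B
        0*y+B≡B y B = trans (cong (_+ B) (ℚ.*-zeroˡ y)) (ℚ.+-identityˡ B)

      rowRelation-lift : weight ≡ 0ℚ → RowRelation reduce g (b ∘ fs) → RowRelation M (p ∷ g) b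
      rowRelation-lift w≡0 rel fz = begin
        sumFinℚ (suc s) (λ j → b j * M ((p ∷ g) j) fz) ≡⟨ combination-pivotColumn ⟩
        weight * M p fz                                      ≡⟨ cong (_* M p fz) w≡0 ⟩
        0ℚ * M p fz                                          ≡⟨ ℚ.*-zeroˡ (M p fz) ⟩
        0ℚ                                                   ∎
        where open ≡-Reasoning
      rowRelation-lift w≡0 rel (fs col) = begin
        sumFinℚ (suc s) (λ j → b j * M ((p ∷ g) j) (fs col))
          ≡⟨ combination-reducedColumn col ⟩
        weight * M p (fs col) + sumFinℚ s (λ j → b (fs j) * reduce (g j) col)
          ≡⟨ cong₂ (λ w B → w * M p (fs col) + B) w≡0 (rel col) ⟩
        0ℚ * M p (fs col) + 0ℚ
          ≡⟨ 0*y+B≡B (M p (fs col)) 0ℚ ⟩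
        0ℚ ∎
        where open ≡-Reasoning

      rowRelation-descend : RowRelation M (p ∷ g) b → weight ≡ 0ℚ × RowRelation reduce g (b ∘ fs)
      rowRelation-descend rel = w≡0 , λ col → begin
        sumFinℚ s (λ j → b (fs j) * reduce (g j) col)
          ≡⟨ 0*y+B≡B (M p (fs col)) _ ⟨
        0ℚ * M p (fs col) + sumFinℚ s (λ j → b (fs j) * reduce (g j) col)
          ≡⟨ cong (λ w → w * M p (fs col) + sumFinℚ s (λ j → b (fs j) * reduce (g j) col)) w≡0 ⟨
        weight * M p (fs col) + sumFinℚ s (λ j → b (fs j) * reduce (g j) col)
          ≡⟨ combination-reducedColumn col ⟨
        sumFinℚ (suc s) (λ j → b j * M ((p ∷ g) j) (fs col))
          ≡⟨ rel (fs col) ⟩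
        0ℚ ∎
        where
        open ≡-Reasoning
        w≡0 : weight ≡ 0ℚ
        w≡0 = p*q≡0⇒p≡0 weight (M p fz) pivot≢0 (trans (sym combination-pivotColumn) (rel fz))

  linIndepRows-dropZeroColumn : ∀ {s t} (a : Fin (suc s) → Fin (suc t) → ℚ) → (∀ i → a i fz ≡ 0ℚ) →
                                LinIndepRows a (λ i → i) →
                                LinIndepRows (λ i j → a (fs i) (fs j)) (λ i → i)
  linIndepRows-dropZeroColumn {s} {t} a zeroColumn ind c rel i = ind (0ℚ ∷ c) extend (fs i)
    where
    tail : Fin (suc t) → ℚ
    tail col = sumFinℚ s (λ i → c i * a (fs i) col)
    extend : RowRelation a (λ i → i) (0ℚ ∷ c)
    extend fz = begin
      0ℚ * a fz fz + tail fz  ≡⟨ cong₂ _+_ (ℚ.*-zeroˡ (a fz fz)) (sumFinℚ-zero s λ i →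
                                   trans (cong (c i *_) (zeroColumn (fs i))) (ℚ.*-zeroʳ (c i))) ⟩
      0ℚ + 0ℚ                 ≡⟨ ℚ.+-identityˡ 0ℚ ⟩
      0ℚ                      ∎
      where open ≡-Reasoning
    extend (fs col) = begin
      0ℚ * a fz (fs col) + tail (fs col)  ≡⟨ cong (_+ tail (fs col)) (ℚ.*-zeroˡ (a fz (fs col))) ⟩
      0ℚ + tail (fs col)                  ≡⟨ ℚ.+-identityˡ (tail (fs col)) ⟩
      tail (fs col)                       ≡⟨ rel col ⟩
      0ℚ                                  ∎
      where open ≡-Reasoning

  module _ {s t} (a : Fin (suc s) → Fin (suc t) → ℚ) (p : Fin (suc s)) (pivot≢0 : a p fz ≢ 0ℚ) where
    open Pivot a p pivot≢0

    linIndepRows-eliminate : LinIndepRows a (λ i → i) → LinIndepRows (reduce ∘ punchIn p) (λ i → i)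
    linIndepRows-eliminate ind c rel i =
      trans (sym (insertAt-punchIn c p c₀ i)) (ind (insertAt c p c₀) extend (punchIn p i))
      where
      S = sumFinℚ s (λ j → c j * ratio (punchIn p j))
      c₀ = - S
      extend : RowRelation a (λ i → i) (insertAt c p c₀)
      extend β = begin
        sumFinℚ (suc s) (λ i → insertAt c p c₀ i * a i β)
          ≡⟨ sumFinℚ-remove s p (λ i → insertAt c p c₀ i * a i β) ⟩
        insertAt c p c₀ p * a p β + sumFinℚ s (λ j → insertAt c p c₀ (punchIn p j) * a (punchIn p j) β)
          ≡⟨ cong₂ (λ x y → x * a p β + y) (insertAt-lookup c p c₀)
                   (sumFinℚ-cong s λ j → cong (_* a (punchIn p j) β) (insertAt-punchIn c p c₀ j)) ⟩
        c₀ * a p β + sumFinℚ s (λ j → c j * a (punchIn p j) β)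
          ≡⟨ rowRelation-lift (punchIn p) (c₀ ∷ c) (ℚ.+-inverseˡ S) rel β ⟩
        0ℚ ∎
        where open ≡-Reasoning

  ¬linIndepRows-tall : ∀ r (a : Fin (suc r) → Fin r → ℚ) → ¬ LinIndepRows a (λ i → i)
  ¬linIndepRows-tall zero    a ind = ℚ.1≢0 (ind (λ _ → 1ℚ) (λ ()) fz)
  ¬linIndepRows-tall (suc r) a ind with allFin? (λ i → a i fz ≟ 0ℚ)
  ... | yes zeroColumn =
    ¬linIndepRows-tall r (λ i j → a (fs i) (fs j)) (linIndepRows-dropZeroColumn a zeroColumn ind)
  ... | no ¬zeroColumn with ¬∀⟶∃¬ _ _ (λ i → a i fz ≟ 0ℚ) ¬zeroColumn
  ... | p , pivot≢0 =
    ¬linIndepRows-tall r (Pivot.reduce a p pivot≢0 ∘ punchIn p) (linIndepRows-eliminate a p pivot≢0 ind)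

  hasRank-basis : ∀ {R C : Set} {M : R → C → ℚ} {r} (f : Fin r → R) →
                  LinIndepRows M f → (∀ x → InSpan M f x) → HasRank M r
  hasRank-basis {M = M} {r} f ind span = (f , ind) , λ u indU →
    ¬linIndepRows-tall r (proj₁ ∘ span ∘ u)
      (linIndepRows-coefficients {M = M} u f (proj₁ ∘ span ∘ u) (proj₂ ∘ span ∘ u) indU)

  Basis : {R C : Set} → (R → C → ℚ) → List R → Set
  Basis {R} M rs = Σ ℕ λ r → Σ (Fin r → R) λ f →
    LinIndepRows M f × (∀ j → f j ∈ rs) × All (InSpan M f) rs

  basis-zeroColumn : ∀ {R : Set} {c} {M : R → Fin (suc c) → ℚ} {rs} → All (λ x → M x fz ≡ 0ℚ) rs →
                     Basis (λ x col → M x (fs col)) rs → Basis M rs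
  basis-zeroColumn {M = M} zeroColumn (r , f , ind , f∈rs , span) =
    r , f , (λ c rel → ind c (rel ∘ fs)) , f∈rs , All.zipWith spanned (zeroColumn , span)
    where
    spanned : ∀ {x} → M x fz ≡ 0ℚ × InSpan (λ x col → M x (fs col)) f x → InSpan M f x
    spanned (Mx≡0 , a , e) = a , λ
      { fz       → trans Mx≡0 (sym (sumFinℚ-zero r λ j →
                     trans (cong (a j *_) (All.lookup zeroColumn (f∈rs j))) (ℚ.*-zeroʳ (a j))))
      ; (fs col) → e col }

  module _ {R : Set} {c} (M : R → Fin (suc c) → ℚ) (p : R) (pivot≢0 : M p fz ≢ 0ℚ) where
    open Pivot M p pivot≢0

    basis-pivot : ∀ {rs} → p ∈ rs → Basis reduce rs → Basis M rs
    basis-pivot {rs} p∈rs (r , f , ind , f∈rs , span) =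
      suc r , p ∷ f , ind′ , f∈rs′ , All.map spanned span
      where
      ind′ : LinIndepRows M (p ∷ f)
      ind′ b rel = λ
        { fz     → begin
            b fz                                             ≡⟨ ℚ.+-identityʳ (b fz) ⟨
            b fz + 0ℚ                                        ≡⟨ cong (b fz +_) (sumFinℚ-zero r tail≡0) ⟨
            b fz + sumFinℚ r (λ j → b (fs j) * ratio (f j))  ≡⟨ w≡0 ⟩
            0ℚ                                               ∎
        ; (fs j) → ind (b ∘ fs) rel′ j }
        where
        open ≡-Reasoning
        w≡0 = proj₁ (rowRelation-descend f b rel)
        rel′ = proj₂ (rowRelation-descend f b rel)
        tail≡0 : ∀ j → b (fs j) * ratio (f j) ≡ 0ℚ
        tail≡0 j = trans (cong (_* ratio (f j)) (ind (b ∘ fs) rel′ j)) (ℚ.*-zeroˡ (ratio (f j)))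
      f∈rs′ : ∀ j → (p ∷ f) j ∈ rs
      f∈rs′ fz     = p∈rs
      f∈rs′ (fs j) = f∈rs j
      spanned : ∀ {x} → InSpan reduce f x → InSpan M (p ∷ f) x
      spanned {x} (a , e) = b₀ ∷ a , λ
        { fz → begin
            M x fz                                                 ≡⟨ ratio-* x ⟨
            ratio x * M p fz                                       ≡⟨ cong (_* M p fz) weight≡ratio ⟨
            weight f (b₀ ∷ a) * M p fz                             ≡⟨ combination-pivotColumn f (b₀ ∷ a) ⟨
            sumFinℚ (suc r) (λ j → (b₀ ∷ a) j * M ((p ∷ f) j) fz)  ∎
        ; (fs col) → begin
            M x (fs col)
              ≡⟨ solve 3 (λ m t y → m := t :* y :+ (m :- t :* y)) refl
                       (M x (fs col)) (ratio x) (M p (fs col)) ⟩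
            ratio x * M p (fs col) + reduce x col
              ≡⟨ cong₂ (λ w B → w * M p (fs col) + B) (sym weight≡ratio) (e col) ⟩
            weight f (b₀ ∷ a) * M p (fs col) + sumFinℚ r (λ j → a j * reduce (f j) col)
              ≡⟨ combination-reducedColumn f (b₀ ∷ a) col ⟨
            sumFinℚ (suc r) (λ j → (b₀ ∷ a) j * M ((p ∷ f) j) (fs col)) ∎ }
        where
        open ≡-Reasoning
        open +-*-Solver
        A = sumFinℚ r (λ j → a j * ratio (f j))
        b₀ = ratio x - A
        weight≡ratio : weight f (b₀ ∷ a) ≡ ratio x
        weight≡ratio = solve 2 (λ t A → (t :- A) :+ A := t) refl (ratio x) A

  basis : ∀ c {R : Set} (M : R → Fin c → ℚ) (rs : List R) → Basis M rs
  basis zero    M rs = 0 , (λ ()) , (λ _ _ ()) , (λ ()) , All.universal (λ _ → (λ ()) , λ ()) rs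
  basis (suc c) M rs with all? (λ x → M x fz ≟ 0ℚ) rs
  ... | yes zeroColumn = basis-zeroColumn zeroColumn (basis c (λ x col → M x (fs col)) rs)
  ... | no ¬zeroColumn with find (¬All⇒Any¬ (λ x → M x fz ≟ 0ℚ) rs ¬zeroColumn)
  ... | p , p∈rs , pivot≢0 = basis-pivot M p pivot≢0 p∈rs (basis c (Pivot.reduce M p pivot≢0) rs)

  hasRank-finite : ∀ {R C : Set} (M : R → C → ℚ) (rs : List R) (cs : List C) →
                   (∀ x → Any (λ y → ∀ β → M x β ≡ M y β) rs) →
                   (∀ β → Any (λ γ → ∀ x → M x β ≡ M x γ) cs) →
                   Σ ℕ (HasRank M)
  hasRank-finite {C = C} M rs cs rowsCover colsCover with basis (length cs) (λ x → M x ∘ lookup cs) rs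
  ... | r , f , ind , _ , span =
    r , hasRank-basis f (linIndepRows-mono {M = λ x → M x ∘ lookup cs} {M} (λ c rel → rel ∘ lookup cs) ind)
                        spanned
    where
    spanned : ∀ x → InSpan M f x
    spanned x with find (rowsCover x)
    ... | y , y∈rs , x≈y with All.lookup span y∈rs
    ... | a , e = a , λ β → begin
      M x β                                  ≡⟨ x≈y β ⟩
      M y β                                  ≡⟨ cover β y ⟩
      M y (γ β)                              ≡⟨ e (Any.index (colsCover β)) ⟩
      sumFinℚ r (λ j → a j * M (f j) (γ β))  ≡⟨ sumFinℚ-cong r (λ j → cong (a j *_) (cover β (f j))) ⟨
      sumFinℚ r (λ j → a j * M (f j) β)      ∎
      where
      open ≡-Reasoning
      γ : C → C
      γ β = lookup cs (Any.index (colsCover β))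
      cover : ∀ β x → M x β ≡ M x (γ β)
      cover β = lookup-index (colsCover β)

module FallingFactorial where

  open import Data.Nat using (pred; _+_; _*_; _!)
  open import Data.Nat.Combinatorics using (_C_; nC1≡n; nCk+nC[k+1]≡[n+1]C[k+1])
  open import Data.Nat.Properties
  open import Data.Nat.Solver using (module +-*-Solver)

  [k+1]*nC[k+1]+k*nCk≡n*nCk : ∀ n k → suc k * (n C suc k) + k * (n C k) ≡ n * (n C k)
  [k+1]*nC[k+1]+k*nCk≡n*nCk zero    zero    = refl
  [k+1]*nC[k+1]+k*nCk≡n*nCk zero    (suc k) = cong₂ _+_ (*-zeroʳ (suc (suc k))) (*-zeroʳ (suc k))
  [k+1]*nC[k+1]+k*nCk≡n*nCk (suc n) zero    = begin
    1 * (suc n C 1) + 0  ≡⟨ +-identityʳ _ ⟩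
    1 * (suc n C 1)    ≡⟨ *-identityˡ _ ⟩
    suc n C 1          ≡⟨ nC1≡n (suc n) ⟩
    suc n              ≡⟨ *-identityʳ (suc n) ⟨
    suc n * 1          ∎
    where open ≡-Reasoning
  [k+1]*nC[k+1]+k*nCk≡n*nCk (suc n) (suc k) = begin
    2+k * (suc n C suc (suc k)) + suc k * (suc n C suc k)
      ≡⟨ cong₂ (λ u v → 2+k * u + suc k * v)
               (nCk+nC[k+1]≡[n+1]C[k+1] n (suc k)) (nCk+nC[k+1]≡[n+1]C[k+1] n k) ⟨
    2+k * (B + B′) + suc k * (A + B)
      ≡⟨ solve 4 (λ k A B B′ → (con 2 :+ k) :* (B :+ B′) :+ (con 1 :+ k) :* (A :+ B)
                            := ((con 2 :+ k) :* B′ :+ (con 1 :+ k) :* B)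
                               :+ ((con 2 :+ k) :* B :+ (con 1 :+ k) :* A))
               refl k A B B′ ⟩
    (2+k * B′ + suc k * B) + (2+k * B + suc k * A)
      ≡⟨ cong (_+ (2+k * B + suc k * A)) ([k+1]*nC[k+1]+k*nCk≡n*nCk n (suc k)) ⟩
    n * B + (2+k * B + suc k * A)
      ≡⟨ solve 4 (λ n k A B → n :* B :+ ((con 2 :+ k) :* B :+ (con 1 :+ k) :* A)
                            := ((con 1 :+ k) :* B :+ k :* A) :+ (A :+ B :+ n :* B))
               refl n k A B ⟩
    (suc k * B + k * A) + (A + B + n * B)
      ≡⟨ cong (_+ (A + B + n * B)) ([k+1]*nC[k+1]+k*nCk≡n*nCk n k) ⟩
    n * A + (A + B + n * B)
      ≡⟨ solve 3 (λ n A B → n :* A :+ (A :+ B :+ n :* B) := (con 1 :+ n) :* (A :+ B)) refl n A B ⟩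
    suc n * (A + B)
      ≡⟨ cong (suc n *_) (nCk+nC[k+1]≡[n+1]C[k+1] n k) ⟩
    suc n * (suc n C suc k) ∎
    where
    open ≡-Reasoning
    open +-*-Solver
    2+k = suc (suc k)
    A = n C k
    B = n C suc k
    B′ = n C suc (suc k)

  [n+1]*nCk+k*[n+1]Ck≡[n+1]*[n+1]Ck : ∀ n k → suc n * (n C k) + k * (suc n C k) ≡ suc n * (suc n C k)
  [n+1]*nCk+k*[n+1]Ck≡[n+1]*[n+1]Ck n zero    = +-identityʳ (suc n * 1)
  [n+1]*nCk+k*[n+1]Ck≡[n+1]*[n+1]Ck n (suc k) = begin
    suc n * B + suc k * (suc n C suc k)
      ≡⟨ cong (λ u → suc n * B + suc k * u) (nCk+nC[k+1]≡[n+1]C[k+1] n k) ⟨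
    suc n * B + suc k * (A + B)
      ≡⟨ solve 4 (λ n k A B → (con 1 :+ n) :* B :+ (con 1 :+ k) :* (A :+ B)
                            := (con 1 :+ n) :* B :+ A :+ ((con 1 :+ k) :* B :+ k :* A)) refl n k A B ⟩
    suc n * B + A + (suc k * B + k * A)
      ≡⟨ cong (suc n * B + A +_) ([k+1]*nC[k+1]+k*nCk≡n*nCk n k) ⟩
    suc n * B + A + n * A
      ≡⟨ solve 3 (λ n A B → (con 1 :+ n) :* B :+ A :+ n :* A := (con 1 :+ n) :* (A :+ B)) refl n A B ⟩
    suc n * (A + B)
      ≡⟨ cong (suc n *_) (nCk+nC[k+1]≡[n+1]C[k+1] n k) ⟩
    suc n * (suc n C suc k) ∎
    where
    open ≡-Reasoning
    open +-*-Solver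
    A = n C k
    B = n C suc k

  -- falling a x = x (x − 1) ⋯ (x − a + 1) is Y^(a)(x); Yval α β is the product of falling (α i) (β i).
  falling : ℕ → ℕ → ℕ
  falling a x = a ! * (x C a)

  falling-lower : ∀ a x → x * falling a (pred x) + a * falling a x ≡ x * falling a x
  falling-lower zero    zero    = refl
  falling-lower (suc a) zero    = trans (cong (suc a *_) (*-zeroʳ (suc a !))) (*-zeroʳ (suc a))
  falling-lower a       (suc n) = begin
    suc n * (a ! * (n C a)) + a * (a ! * (suc n C a))
      ≡⟨ solve 5 (λ n a f A B → (con 1 :+ n) :* (f :* A) :+ a :* (f :* B)
                              := f :* ((con 1 :+ n) :* A :+ a :* B)) refl n a (a !) (n C a) (suc n C a) ⟩
    a ! * (suc n * (n C a) + a * (suc n C a))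
      ≡⟨ cong (a ! *_) ([n+1]*nCk+k*[n+1]Ck≡[n+1]*[n+1]Ck n a) ⟩
    a ! * (suc n * (suc n C a))
      ≡⟨ x*[y*z]≡y*[x*z] (a !) (suc n) _ ⟩
    suc n * (a ! * (suc n C a)) ∎
    where
    open ≡-Reasoning
    open +-*-Solver
    x*[y*z]≡y*[x*z] : ∀ x y z → x * (y * z) ≡ y * (x * z)
    x*[y*z]≡y*[x*z] = solve 3 (λ x y z → x :* (y :* z) := y :* (x :* z)) refl

module Grid where

  open FallingFactorial
  import Algebra.Properties.CommutativeMonoid.Sum as CommutativeMonoidSum
  import Algebra.Properties.Semiring.Sum as SemiringSum
  open import Data.Fin as Fin using (toℕ)
  open import Data.Fin.Properties using (toℕ-inject₁; punchInᵢ≢i)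
  open import Data.List using (List; []; _∷_; allFin; cartesianProductWith)
  open import Data.List.Membership.Propositional.Properties using (∈-allFin)
  open import Data.List.Relation.Unary.Any using (Any; here; there)
  open import Data.List.Relation.Unary.Any.Properties using (cartesianProductWith⁺)
  open import Data.Nat using (pred; _+_; _*_)
  open import Data.Nat.Properties using (+-*-semiring; *-1-commutativeMonoid; *-assoc)
  open import Data.Nat.Solver using (module +-*-Solver)
  open import Data.Vec.Functional using (removeAt)
  open import Relation.Unary using (Decidable)

  private
    module ℕΣ = SemiringSum +-*-semiring
    module ℕΠ = CommutativeMonoidSum *-1-commutativeMonoid

  sumFinℕ≡sum : ∀ n (f : Fin n → ℕ) → sumFinℕ n f ≡ ℕΣ.sum f
  sumFinℕ≡sum zero    f = refl
  sumFinℕ≡sum (suc n) f = cong (f fz +_) (sumFinℕ≡sum n (f ∘ fs))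

  prodFinℕ≡product : ∀ n (f : Fin n → ℕ) → prodFinℕ n f ≡ ℕΠ.sum f
  prodFinℕ≡product zero    f = refl
  prodFinℕ≡product (suc n) f = cong (f fz *_) (prodFinℕ≡product n (f ∘ fs))

  sumFinℕ-remove : ∀ n (i : Fin (suc n)) (f : Fin (suc n) → ℕ) →
                   sumFinℕ (suc n) f ≡ f i + sumFinℕ n (removeAt f i)
  sumFinℕ-remove n i f rewrite sumFinℕ≡sum (suc n) f | sumFinℕ≡sum n (removeAt f i) =
    ℕΣ.sum-remove f

  prodFinℕ-remove : ∀ n (i : Fin (suc n)) (f : Fin (suc n) → ℕ) →
                    prodFinℕ (suc n) f ≡ f i * prodFinℕ n (removeAt f i)
  prodFinℕ-remove n i f rewrite prodFinℕ≡product (suc n) f | prodFinℕ≡product n (removeAt f i) =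
    ℕΠ.sum-remove f

  sumFinℕ-cong : ∀ n {f g : Fin n → ℕ} → (∀ i → f i ≡ g i) → sumFinℕ n f ≡ sumFinℕ n g
  sumFinℕ-cong zero    f≗g = refl
  sumFinℕ-cong (suc n) f≗g = cong₂ _+_ (f≗g fz) (sumFinℕ-cong n (f≗g ∘ fs))

  prodFinℕ-cong : ∀ n {f g : Fin n → ℕ} → (∀ i → f i ≡ g i) → prodFinℕ n f ≡ prodFinℕ n g
  prodFinℕ-cong zero    f≗g = refl
  prodFinℕ-cong (suc n) f≗g = cong₂ _*_ (f≗g fz) (prodFinℕ-cong n (f≗g ∘ fs))

  toℕ-pred : ∀ {m} (x : Fin m) → toℕ (Fin.pred x) ≡ pred (toℕ x)
  toℕ-pred fz     = refl
  toℕ-pred (fs x) = toℕ-inject₁ x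

  -- lower i β is β − e_i, except that a zero coordinate stays 0; such terms always carry the factor β_i = 0.
  lower : ∀ {n} {k : Fin n → ℕ} → Fin n → G n k → G n k
  lower i β j with i Fin.≟ j
  ... | yes _ = Fin.pred (β j)
  ... | no  _ = β j

  module _ {n} {k : Fin n → ℕ} (i : Fin n) (β : G n k) where

    toℕ-lower-self : toℕ (lower i β i) ≡ pred (toℕ (β i))
    toℕ-lower-self with i Fin.≟ i
    ... | yes _  = toℕ-pred (β i)
    ... | no i≢i = contradiction refl i≢i

    lower-off : ∀ j → i ≢ j → lower i β j ≡ β j
    lower-off j i≢j with i Fin.≟ j
    ... | yes i≡j = contradiction i≡j i≢j
    ... | no  _   = refl

  lower-punchIn : ∀ {n} {k : Fin (suc n) → ℕ} i (β : G (suc n) k) j →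
                  lower i β (punchIn i j) ≡ β (punchIn i j)
  lower-punchIn i β j = lower-off i β (punchIn i j) (punchInᵢ≢i i j ∘ sym)

  wt-lower : ∀ {n} {k : Fin n → ℕ} (i : Fin n) (β : G n k) {q} → toℕ (β i) ≡ suc q →
             suc (wt {n} {k} (lower i β)) ≡ wt {n} {k} β
  wt-lower {suc n} i β {q} βi≡1+q = begin
    suc (wt (lower i β))
      ≡⟨ cong suc (sumFinℕ-remove n i (λ j → toℕ (lower i β j))) ⟩
    suc (toℕ (lower i β i) + sumFinℕ n (λ j → toℕ (lower i β (punchIn i j))))
      ≡⟨ cong₂ (λ x y → suc (x + y)) (trans (toℕ-lower-self i β) (cong pred βi≡1+q))
                                     (sumFinℕ-cong n (cong toℕ ∘ lower-punchIn i β)) ⟩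
    suc q + sumFinℕ n (λ j → toℕ (β (punchIn i j)))
      ≡⟨ cong (_+ sumFinℕ n (λ j → toℕ (β (punchIn i j)))) βi≡1+q ⟨
    toℕ (β i) + sumFinℕ n (λ j → toℕ (β (punchIn i j)))
      ≡⟨ sumFinℕ-remove n i (λ j → toℕ (β j)) ⟨
    wt β ∎
    where open ≡-Reasoning

  Yval-lower : ∀ {n} {k : Fin n → ℕ} (α β : G n k) i →
               toℕ (β i) * Yval n k α (lower i β) + toℕ (α i) * Yval n k α β ≡ toℕ (β i) * Yval n k α β
  Yval-lower {suc n} {k} α β i = begin
    b * Yval (suc n) k α (lower i β) + a * Yval (suc n) k α β
      ≡⟨ cong₂ (λ x y → b * x + a * y) Yval-lower-factor (prodFinℕ-remove n i (F β)) ⟩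
    b * (falling a (pred b) * R) + a * (falling a b * R)
      ≡⟨ solve 5 (λ b a F′ F R → b :* (F′ :* R) :+ a :* (F :* R) := (b :* F′ :+ a :* F) :* R)
               refl b a (falling a (pred b)) (falling a b) R ⟩
    (b * falling a (pred b) + a * falling a b) * R
      ≡⟨ cong (_* R) (falling-lower a b) ⟩
    b * falling a b * R
      ≡⟨ *-assoc b (falling a b) R ⟩
    b * (falling a b * R)
      ≡⟨ cong (b *_) (prodFinℕ-remove n i (F β)) ⟨
    b * Yval (suc n) k α β ∎
    where
    open ≡-Reasoning
    open +-*-Solver
    a = toℕ (α i)
    b = toℕ (β i)
    F : G (suc n) k → Fin (suc n) → ℕ
    F γ j = falling (toℕ (α j)) (toℕ (γ j))
    R = prodFinℕ n (removeAt (F β) i)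
    Yval-lower-factor : Yval (suc n) k α (lower i β) ≡ falling a (pred b) * R
    Yval-lower-factor = trans (prodFinℕ-remove n i (F (lower i β)))
      (cong₂ _*_ (cong (falling a) (toℕ-lower-self i β))
                 (prodFinℕ-cong n λ j →
                    cong (falling (toℕ (α (punchIn i j))) ∘ toℕ) (lower-punchIn i β j)))

  -- Grid points are functions, so a list can enumerate G only up to pointwise equality.
  _≈ᴳ_ : ∀ {n} {k : Fin n → ℕ} → G n k → G n k → Set
  x ≈ᴳ y = ∀ i → x i ≡ y i

  wt-cong : ∀ {n} {k : Fin n → ℕ} {x y : G n k} → x ≈ᴳ y → wt {n} {k} x ≡ wt {n} {k} y
  wt-cong {n} x≈y = sumFinℕ-cong n (cong toℕ ∘ x≈y)

  Yval-cong : ∀ {n} {k : Fin n → ℕ} {α α′ β β′ : G n k} → α ≈ᴳ α′ → β ≈ᴳ β′ →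
              Yval n k α β ≡ Yval n k α′ β′
  Yval-cong {n} α≈α′ β≈β′ =
    prodFinℕ-cong n λ i → cong₂ (λ a b → falling (toℕ a) (toℕ b)) (α≈α′ i) (β≈β′ i)

  _∷ᴳ_ : ∀ {n} {k : Fin (suc n) → ℕ} → Fin (k fz) → G n (k ∘ fs) → G (suc n) k
  (a ∷ᴳ x) fz     = a
  (a ∷ᴳ x) (fs i) = x i

  allGrid : (n : ℕ) (k : Fin n → ℕ) → List (G n k)
  allGrid zero    k = (λ ()) ∷ []
  allGrid (suc n) k = cartesianProductWith _∷ᴳ_ (allFin (k fz)) (allGrid n (k ∘ fs))

  allGrid-complete : ∀ n (k : Fin n → ℕ) (x : G n k) → Any (x ≈ᴳ_) (allGrid n k)
  allGrid-complete zero    k x = here λ ()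
  allGrid-complete (suc n) k x =
    cartesianProductWith⁺ _∷ᴳ_ (λ x₀≡a xs≈y → λ { fz → x₀≡a ; (fs i) → xs≈y i })
      (∈-allFin (x fz)) (allGrid-complete n (k ∘ fs) (x ∘ fs))

  module _ {n} {k : Fin n → ℕ} {F : ℕ → Set} (F? : Decidable F) where

    underline : List (G n k) → List (Under n k F)
    underline []       = []
    underline (x ∷ xs) with F? (wt x)
    ... | yes Fx = (x , Fx) ∷ underline xs
    ... | no  _  = underline xs

    underline-complete : ∀ xs (x : G n k) → F (wt x) → Any (x ≈ᴳ_) xs →
                         Any (λ y → x ≈ᴳ proj₁ y) (underline xs)
    underline-complete (y ∷ xs) x Fx (here x≈y) with F? (wt y)
    ... | yes _  = here x≈y
    ... | no ¬Fy = contradiction (subst F (wt-cong x≈y) Fx) ¬Fy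
    underline-complete (y ∷ xs) x Fx (there x∈xs) with F? (wt y)
    ... | yes _ = there (underline-complete xs x Fx x∈xs)
    ... | no  _ = underline-complete xs x Fx x∈xs

module EvaluationMatrix where

  open RationalSums
  open RowRank
  open Grid
  open import Data.Fin using (toℕ)
  open import Data.List.Relation.Unary.Any as Any using (Any)
  open import Data.Nat as ℕ using (_<_; _≤_; _∸_)
  import Data.Nat.Properties as ℕ
  open import Data.Rational using (ℚ; 0ℚ; _+_; _*_)
  import Data.Rational.Properties as ℚ
  open import Data.Rational.Solver using (module +-*-Solver)

  module _ {n} {k : Fin n → ℕ} where

    EulerRelation : ℕ → (G n k → ℚ) → Set
    EulerRelation d S = ∀ β →
      sumFinℚ n (λ i → ℕtoℚ (toℕ (β i)) * S (lower i β)) + ℕtoℚ d * S β ≡ ℕtoℚ (wt {n} {k} β) * S β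

    Yval-eulerRelation : ∀ α → EulerRelation (wt {n} {k} α) (ℕtoℚ ∘ Yval n k α)
    Yval-eulerRelation α β = begin
      sumFinℚ n (λ i → b i * Y (lower i β)) + ℕtoℚ (wt α) * Y β
        ≡⟨ cong (sumFinℚ n (λ i → b i * Y (lower i β)) +_) (scale α) ⟩
      sumFinℚ n (λ i → b i * Y (lower i β)) + sumFinℚ n (λ i → a i * Y β)
        ≡⟨ sumFinℚ-distrib-+ n (λ i → b i * Y (lower i β)) (λ i → a i * Y β) ⟨
      sumFinℚ n (λ i → b i * Y (lower i β) + a i * Y β)
        ≡⟨ sumFinℚ-cong n coordinate ⟩
      sumFinℚ n (λ i → b i * Y β)
        ≡⟨ scale β ⟨
      ℕtoℚ (wt β) * Y β ∎
      where
      open ≡-Reasoning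
      Y : G n k → ℚ
      Y = ℕtoℚ ∘ Yval n k α
      a b : Fin n → ℚ
      a i = ℕtoℚ (toℕ (α i))
      b i = ℕtoℚ (toℕ (β i))
      scale : ∀ γ → ℕtoℚ (wt {n} {k} γ) * Y β ≡ sumFinℚ n (λ i → ℕtoℚ (toℕ (γ i)) * Y β)
      scale γ = trans (cong (_* Y β) (ℕtoℚ-sum n (λ i → toℕ (γ i))))
                      (*-distribʳ-sumFinℚ n (Y β) (λ i → ℕtoℚ (toℕ (γ i))))
      coordinate : ∀ i → b i * Y (lower i β) + a i * Y β ≡ b i * Y β
      coordinate i = begin
        b i * Y (lower i β) + a i * Y β
          ≡⟨ cong₂ _+_ (ℕtoℚ-* (toℕ (β i)) (Yval n k α (lower i β)))
                       (ℕtoℚ-* (toℕ (α i)) (Yval n k α β)) ⟨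
        ℕtoℚ (toℕ (β i) ℕ.* Yval n k α (lower i β)) + ℕtoℚ (toℕ (α i) ℕ.* Yval n k α β)
          ≡⟨ ℕtoℚ-+ (toℕ (β i) ℕ.* Yval n k α (lower i β)) (toℕ (α i) ℕ.* Yval n k α β) ⟨
        ℕtoℚ (toℕ (β i) ℕ.* Yval n k α (lower i β) ℕ.+ toℕ (α i) ℕ.* Yval n k α β)
          ≡⟨ cong ℕtoℚ (Yval-lower α β i) ⟩
        ℕtoℚ (toℕ (β i) ℕ.* Yval n k α β)
          ≡⟨ ℕtoℚ-* (toℕ (β i)) (Yval n k α β) ⟩
        b i * Y β ∎

    eulerRelation-combination : ∀ {d r} (c : Fin r → ℚ) (S : Fin r → G n k → ℚ) →
                                (∀ j → EulerRelation d (S j)) →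
                                EulerRelation d (λ β → sumFinℚ r (λ j → c j * S j β))
    eulerRelation-combination {d} {r} c S euler β = begin
      sumFinℚ n (λ i → b i * sumFinℚ r (λ j → c j * S j (lower i β))) + D * sumFinℚ r (λ j → c j * S j β)
        ≡⟨ cong₂ _+_ lowered (*-distribˡ-sumFinℚ r D _) ⟩
      sumFinℚ r (λ j → c j * L j) + sumFinℚ r (λ j → D * (c j * S j β))
        ≡⟨ sumFinℚ-distrib-+ r _ _ ⟨
      sumFinℚ r (λ j → c j * L j + D * (c j * S j β))
        ≡⟨ sumFinℚ-cong r (λ j → rearrange (c j) (L j) D (S j β)) ⟩
      sumFinℚ r (λ j → c j * (L j + D * S j β))
        ≡⟨ sumFinℚ-cong r (λ j → cong (c j *_) (euler j β)) ⟩
      sumFinℚ r (λ j → c j * (W * S j β))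
        ≡⟨ sumFinℚ-cong r (λ j → x*[y*z]≡y*[x*z] (c j) W (S j β)) ⟩
      sumFinℚ r (λ j → W * (c j * S j β))
        ≡⟨ *-distribˡ-sumFinℚ r W _ ⟨
      W * sumFinℚ r (λ j → c j * S j β) ∎
      where
      open ≡-Reasoning
      open +-*-Solver
      b : Fin n → ℚ
      b i = ℕtoℚ (toℕ (β i))
      D = ℕtoℚ d
      W = ℕtoℚ (wt {n} {k} β)
      L : Fin r → ℚ
      L j = sumFinℚ n (λ i → b i * S j (lower i β))
      x*[y*z]≡y*[x*z] : ∀ x y z → x * (y * z) ≡ y * (x * z)
      x*[y*z]≡y*[x*z] = solve 3 (λ x y z → x :* (y :* z) := y :* (x :* z)) refl
      rearrange : ∀ c L D s → c * L + D * (c * s) ≡ c * (L + D * s)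
      rearrange = solve 4 (λ c L D s → c :* L :+ D :* (c :* s) := c :* (L :+ D :* s)) refl
      lowered : sumFinℚ n (λ i → b i * sumFinℚ r (λ j → c j * S j (lower i β))) ≡
                sumFinℚ r (λ j → c j * L j)
      lowered = begin
        sumFinℚ n (λ i → b i * sumFinℚ r (λ j → c j * S j (lower i β)))
          ≡⟨ sumFinℚ-cong n (λ i → *-distribˡ-sumFinℚ r (b i) _) ⟩
        sumFinℚ n (λ i → sumFinℚ r (λ j → b i * (c j * S j (lower i β))))
          ≡⟨ sumFinℚ-comm n r _ ⟩
        sumFinℚ r (λ j → sumFinℚ n (λ i → b i * (c j * S j (lower i β))))
          ≡⟨ sumFinℚ-cong r (λ j → sumFinℚ-cong n (λ i → x*[y*z]≡y*[x*z] (b i) (c j) _)) ⟩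
        sumFinℚ r (λ j → sumFinℚ n (λ i → c j * (b i * S j (lower i β))))
          ≡⟨ sumFinℚ-cong r (λ j → *-distribˡ-sumFinℚ n (c j) _) ⟨
        sumFinℚ r (λ j → c j * L j) ∎

    -- At weight w > d the relation reads (w − d)·S β = Σ_i β_i S(β − e_i), and the right side vanishes by
    -- induction on w − m.
    eulerRelation-vanishing : ∀ {d m} {S : G n k → ℚ} → EulerRelation d S → d < m →
                              (∀ β → wt {n} {k} β ≡ m → S β ≡ 0ℚ) → ∀ β → m ≤ wt {n} {k} β → S β ≡ 0ℚ
    eulerRelation-vanishing {d} {m} {S} euler d<m S≡0 β m≤wtβ =
      vanish (wt β ∸ m) β (sym (ℕ.m+[n∸m]≡n m≤wtβ))
      where
      vanish : ∀ t β → wt {n} {k} β ≡ m ℕ.+ t → S β ≡ 0ℚ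
      vanish zero    β wtβ≡m+0   = S≡0 β (trans wtβ≡m+0 (ℕ.+-identityʳ m))
      vanish (suc t) β wtβ≡m+1+t = ℕtoℚ-*-cancel (S β) d<wtβ (begin
        ℕtoℚ d * S β
          ≡⟨ ℚ.+-identityˡ (ℕtoℚ d * S β) ⟨
        0ℚ + ℕtoℚ d * S β
          ≡⟨ cong (_+ ℕtoℚ d * S β) (sumFinℚ-zero n term≡0) ⟨
        sumFinℚ n (λ i → ℕtoℚ (toℕ (β i)) * S (lower i β)) + ℕtoℚ d * S β
          ≡⟨ euler β ⟩
        ℕtoℚ (wt β) * S β ∎)
        where
        open ≡-Reasoning
        d<wtβ : d < wt β
        d<wtβ = ℕ.<-≤-trans d<m (subst (m ≤_) (sym wtβ≡m+1+t) (ℕ.m≤m+n m (suc t)))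
        term≡0 : ∀ i → ℕtoℚ (toℕ (β i)) * S (lower i β) ≡ 0ℚ
        term≡0 i with toℕ (β i) in βi≡
        ... | zero  = ℚ.*-zeroˡ (S (lower i β))
        ... | suc q = trans (cong (ℕtoℚ (suc q) *_) (vanish t (lower i β)
                        (ℕ.suc-injective (trans (wt-lower i β βi≡) (trans wtβ≡m+1+t (ℕ.+-suc m t))))))
                      (ℚ.*-zeroʳ (ℕtoℚ (suc q)))

  module _ {n} {k : Fin n → ℕ} {d m : ℕ} where

    Ev-hasRank : Σ ℕ (HasRank (Ev n k (_≡ d) (_≡ m)))
    Ev-hasRank = hasRank-finite (Ev n k (_≡ d) (_≡ m))
      (underline (ℕ._≟ d) (allGrid n k)) (underline (ℕ._≟ m) (allGrid n k))
      (λ (α , wα≡d) → Any.map (λ α≈α′ (β , _) → cong ℕtoℚ (Yval-cong {β = β} α≈α′ λ _ → refl))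
                        (underline-complete (ℕ._≟ d) (allGrid n k) α wα≡d (allGrid-complete n k α)))
      (λ (β , wβ≡m) → Any.map (λ β≈β′ (α , _) → cong ℕtoℚ (Yval-cong {α = α} (λ _ → refl) β≈β′))
                        (underline-complete (ℕ._≟ m) (allGrid n k) β wβ≡m (allGrid-complete n k β)))

    rowRelation-restrict : ∀ {E : ℕ → Set} {s} (f : Fin s → Under n k (_≡ d)) c → E m →
                           RowRelation (Ev n k (_≡ d) E) f c → RowRelation (Ev n k (_≡ d) (_≡ m)) f c
    rowRelation-restrict {E} f c Em rel (β , wβ≡m) = rel (β , subst E (sym wβ≡m) Em)

    rowRelation-upward : ∀ {E : ℕ → Set} {s} (f : Fin s → Under n k (_≡ d)) c →
                         d < m → (∀ e → E e → m ≤ e) →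
                         RowRelation (Ev n k (_≡ d) (_≡ m)) f c → RowRelation (Ev n k (_≡ d) E) f c
    rowRelation-upward {s = s} f c d<m m≤E rel (β , Eβ) =
      eulerRelation-vanishing {n} {k} {d} {m} euler d<m (λ γ wγ≡m → rel (γ , wγ≡m)) β (m≤E (wt β) Eβ)
      where
      euler : EulerRelation d (λ γ → sumFinℚ s (λ j → c j * ℕtoℚ (Yval n k (proj₁ (f j)) γ)))
      euler = eulerRelation-combination {n} {k} {d} c (λ j → ℕtoℚ ∘ Yval n k (proj₁ (f j))) λ j →
        subst (λ w → EulerRelation w (ℕtoℚ ∘ Yval n k (proj₁ (f j))))
              (proj₂ (f j)) (Yval-eulerRelation (proj₁ (f j)))

open RowRank using (hasRank-transfer)
open EvaluationMatrix

open import Data.Nat using (ℕ; _≤_; _<_; _+_; _∸_; ⌊_/2⌋; s≤s)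
open import Data.Nat.Properties
  using (≤-trans; <-≤-trans; +-comm; +-mono-≤; ⌊n/2⌋≤⌈n/2⌉; ⌊n/2⌋+⌈n/2⌉≡n; m+n≤o⇒m≤o∸n)

m≤⌊n/2⌋⇒m<n∸m+1 : ∀ {m n} → m ≤ ⌊ n /2⌋ → m < n ∸ m + 1
m≤⌊n/2⌋⇒m<n∸m+1 {m} {n} m≤⌊n/2⌋ = subst (m <_) (+-comm 1 (n ∸ m)) (s≤s (m+n≤o⇒m≤o∸n m m+m≤n))
  where
  m+m≤n : m + m ≤ n
  m+m≤n = subst (m + m ≤_) (⌊n/2⌋+⌈n/2⌉≡n n) (+-mono-≤ m≤⌊n/2⌋ (≤-trans m≤⌊n/2⌋ (⌊n/2⌋≤⌈n/2⌉ n)))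

lemma1p6 : (n : ℕ) (k : Fin n → ℕ) → ((i : Fin n) → 2 ≤ k i) →
    (d : ℕ) → d ≤ ⌊ Ntot n k /2⌋ →
    (E : ℕ → Set) → ((e : ℕ) → E e → (Ntot n k ∸ d + 1 ≤ e) × (e ≤ Ntot n k)) →
    (m : ℕ) → E m → ((e : ℕ) → E e → m ≤ e) →
    Σ ℕ (λ r → HasRank (Ev n k (λ w → w ≡ d) E) r
              × HasRank (Ev n k (λ w → w ≡ d) (λ w → w ≡ m)) r)
lemma1p6 n k _ d d≤⌊N/2⌋ E E⊆[N-d+1,N] m Em m≤E =
  r , hasRank-transfer {M = Ev n k (_≡ d) (_≡ m)} {M′ = Ev n k (_≡ d) E} upward restrict rank , rank
  where
  d<m : d < m
  d<m = <-≤-trans (m≤⌊n/2⌋⇒m<n∸m+1 d≤⌊N/2⌋) (proj₁ (E⊆[N-d+1,N] m Em))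
  r = proj₁ (Ev-hasRank {n} {k} {d} {m})
  rank = proj₂ (Ev-hasRank {n} {k} {d} {m})
  upward = λ {s} f c → rowRelation-upward {n} {k} {d} {m} {E} {s} f c d<m m≤E
  restrict = λ {s} f c → rowRelation-restrict {n} {k} {d} {m} {E} {s} f c Em
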